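{- Let $a_1<a_2<\cdots<a_n$ be the smaller elements of the arches of a noncrossing perfect matching of $\{1,\ldots,2n\}$. For $1\le k\le n$ let $M^{(k)}$ be the $n\times n$ matrix with entries \[ M^{(k)}_{ij}=\begin{cases}\dfrac{1}{(a_i-j)!} & i\neq k,\\[2mm] \dfrac{(a_i-j)(a_i-j-1)}{(a_i-j)!} & i=k,\end{cases} \] and $M$ the $n\times n$ matrix with $M_{ij}=\frac{1}{(a_i-j)!}$. Then \[ \sum_{k=1}^n\det M^{(k)}=\left(\sum_{k=1}^n (a_k-k)(a_k-2n+k-1)\right)\det M. \]
   Context: A matching of size $n$ is a set of $n$ disjoint pairs (arches) whose union is $\{1,\ldots,2n\}$, noncrossing: no two arches $\{i<j\}$, $\{k<l\}$ with $i<k<j<l$. The convention $1/m!=0$ for negative integers $m$ is used. -}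

module Defs where

open import Data.Nat as ℕ using (ℕ; zero; suc; _!; _≤_; _<_)
open import Data.Nat.Properties using (_!≢0)
open import Data.Integer as ℤ using (ℤ; +_; -[1+_])
open import Data.Rational as ℚ using (ℚ; 0ℚ; 1ℚ; _/_; _+_; _*_; -_)
open import Data.Fin as Fin using (Fin; toℕ; punchIn)
open import Data.Product using (Σ; _×_; ∃)
open import Data.Sum using (_⊎_)
open import Relation.Binary.PropositionalEquality using (_≡_; _≢_)
open import Relation.Nullary using (¬_; yes; no)

-- 1/m! for an integer m, with the convention 1/m! = 0 for m < 0.
invFact : ℤ → ℚ
invFact (+ m) = _/_ (+ 1) (m !) {{m !≢0}}
invFact -[1+ _ ] = 0ℚ

intToℚ : ℤ → ℚ
intToℚ z = z / 1

sumFin : ∀ {n} → (Fin n → ℚ) → ℚ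
sumFin {zero} f = 0ℚ
sumFin {suc n} f = f Fin.zero + sumFin (λ i → f (Fin.suc i))

sumFinℤ : ∀ {n} → (Fin n → ℤ) → ℤ
sumFinℤ {zero} f = + 0
sumFinℤ {suc n} f = f Fin.zero ℤ.+ sumFinℤ (λ i → f (Fin.suc i))

signℚ : ℕ → ℚ
signℚ zero = 1ℚ
signℚ (suc k) = - signℚ k

-- n×n matrices over ℚ, indexed 0..n-1 (row i, column j correspond to i+1, j+1)
Matrix : ℕ → Set
Matrix n = Fin n → Fin n → ℚ

det : ∀ {n} → Matrix n → ℚ
det {zero} M = 1ℚ
det {suc n} M =
  sumFin (λ j → signℚ (toℕ j) * (M Fin.zero j * det (λ r c → M (Fin.suc r) (punchIn j c))))

-- a : Fin n → ℕ lists (in increasing order) the smaller elements of the arches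
-- of a noncrossing perfect matching of {1,…,2n}; b i is the partner of a i.
IsNCMatching : (n : ℕ) → (a b : Fin n → ℕ) → Set
IsNCMatching n a b =
    (∀ i j → i Fin.< j → a i < a j)
  × (∀ i → a i < b i)
  × (∀ i → 1 ≤ a i × b i ≤ 2 ℕ.* n)
  × (∀ i j → a i ≢ b j)
  × (∀ i j → b i ≡ b j → i ≡ j)
  × (∀ x → 1 ≤ x → x ≤ 2 ℕ.* n → ∃ λ i → a i ≡ x ⊎ b i ≡ x)
  × (∀ i j → ¬ (a i < a j × a j < b i × b i < b j))

SmallerElements : (n : ℕ) → (Fin n → ℕ) → Set
SmallerElements n a = Σ (Fin n → ℕ) λ b → IsNCMatching n a b

-- a_i - j with 1-based indices
diff : ∀ {n} → (Fin n → ℕ) → Fin n → Fin n → ℤ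
diff a i j = + a i ℤ.- + suc (toℕ j)

matM : ∀ {n} → (Fin n → ℕ) → Matrix n
matM a i j = invFact (diff a i j)

matMk : ∀ {n} → (Fin n → ℕ) → Fin n → Matrix n
matMk a k i j with i Fin.≟ k
... | yes _ =
      intToℚ (diff a i j ℤ.* (diff a i j ℤ.- + 1)) * invFact (diff a i j)
... | no _ = invFact (diff a i j)

coeff : ∀ n → (Fin n → ℕ) → ℤ
coeff n a = sumFinℤ (λ k →
  (+ a k ℤ.- + suc (toℕ k)) ℤ.* (+ a k ℤ.- + (2 ℕ.* n) ℤ.+ + suc (toℕ k) ℤ.- + 1))

module Submission where

-- The identity holds for any naturals a₁,…,aₙ.  Write Xᵢ = aᵢ, Jⱼ = j and D = det M.  Since
--   (aₖ-j)(aₖ-j-1) = Xₖ² - (2Jⱼ+1)·Xₖ + Jⱼ(Jⱼ+1),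
-- linearity of det in row k turns Σₖ det M⁽ᵏ⁾ into ΣXₖ²·D plus two sums of
-- row replacements.  A general fact moves such sums to column replacements
-- (both are the derivative of det(M + tN) at t = 0).  In columns, the
-- factorial recurrence Xᵢ·Mᵢⱼ = 1/(aᵢ-j-1)! + Jⱼ·Mᵢⱼ makes each replacement
-- Jⱼ·D plus a determinant with two equal adjacent columns (hence 0), except
-- at the last column, where an unknown G appears; running the same argument
-- with all weights 1 gives G = (ΣXₖ - ΣJₖ)·D.  What remains is a per-index
-- polynomial identity.

open import Defs
open import Data.Nat using (ℕ)
open import Data.Fin using (Fin)
open import Data.Rational using (_*_)
open import Relation.Binary.PropositionalEquality using (_≡_)

open import Data.Nat as N using (zero; suc; _!)
open import Data.Nat.Properties using (_!≢0)
import Data.Nat.Properties as NP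
import Data.Nat.Coprimality as C
open import Data.Integer as Z using (ℤ; +_; -[1+_])
import Data.Integer.Properties as IP
open import Data.Rational as Q using (ℚ; mkℚ; _+_; -_; _-_; 0ℚ; 1ℚ; _/_)
import Data.Rational.Properties as QP
open import Data.Rational.Solver using (module +-*-Solver)
open import Data.Fin as F using (toℕ; punchIn; punchOut; inject₁; fromℕ)
import Data.Fin.Properties as FP
open import Data.Product using (Σ; _,_; _×_)
open import Data.Empty using (⊥-elim)
open import Relation.Binary.PropositionalEquality
  using (_≢_; refl; sym; trans; cong; cong₂; module ≡-Reasoning)
open import Relation.Nullary using (yes; no)

open +-*-Solver using (solve; _:=_; _:+_; _:*_; _:-_; :-_; con)

-- intToℚ z is the already-normalised fraction z/1; from this, intToℚ
-- commutes with +, *, negation, subtraction and finite sums.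
intToℚ-normal : ∀ z → intToℚ z ≡ mkℚ z 0 (C.sym (C.1-coprimeTo _))
intToℚ-normal (+ n)    = QP.normalize-coprime {n} {0} _
intToℚ-normal -[1+ n ] = cong -_ (QP.normalize-coprime {suc n} {0} _)

intToℚ-+ : ∀ x y → intToℚ (x Z.+ y) ≡ intToℚ x + intToℚ y
intToℚ-+ x y =
  trans (cong intToℚ (cong₂ Z._+_ (sym (IP.*-identityʳ x)) (sym (IP.*-identityʳ y))))
        (sym (cong₂ _+_ (intToℚ-normal x) (intToℚ-normal y)))

intToℚ-* : ∀ x y → intToℚ (x Z.* y) ≡ intToℚ x * intToℚ y
intToℚ-* x y = sym (cong₂ _*_ (intToℚ-normal x) (intToℚ-normal y))

intToℚ-neg : ∀ x → intToℚ (Z.- x) ≡ - intToℚ x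
intToℚ-neg (+ zero)  = refl
intToℚ-neg (+ suc n) = trans (intToℚ-normal -[1+ n ]) (cong -_ (sym (intToℚ-normal (+ suc n))))
intToℚ-neg -[1+ n ]  = trans (intToℚ-normal (+ suc n)) (cong -_ (sym (intToℚ-normal -[1+ n ])))

intToℚ-- : ∀ x y → intToℚ (x Z.- y) ≡ intToℚ x - intToℚ y
intToℚ-- x y = trans (intToℚ-+ x (Z.- y)) (cong (_+_ (intToℚ x)) (intToℚ-neg y))

intToℚ-sum : ∀ {n} (g : Fin n → ℤ) → intToℚ (sumFinℤ g) ≡ sumFin (λ k → intToℚ (g k))
intToℚ-sum {zero}  g = refl
intToℚ-sum {suc n} g =
  trans (intToℚ-+ (g F.zero) (sumFinℤ (λ i → g (F.suc i))))
        (cong (_+_ (intToℚ (g F.zero))) (intToℚ-sum (λ i → g (F.suc i))))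

recip-cancel : ∀ d .{{_ : N.NonZero d}} → (+ 1 / d) * intToℚ (+ d) ≡ 1ℚ
recip-cancel (suc d) = begin
  (+ 1 / suc d) * intToℚ (+ suc d)
    ≡⟨ cong₂ _*_ (QP.normalize-coprime {1} {d} (C.1-coprimeTo _)) (intToℚ-normal (+ suc d)) ⟩
  _ ≡⟨ QP.*-inverseˡ (mkℚ (+ suc d) 0 (C.sym (C.1-coprimeTo _))) ⟩
  1ℚ ∎
  where open ≡-Reasoning

*-cancelʳ-invertible : ∀ x y c c⁻¹ → c * c⁻¹ ≡ 1ℚ → x * c ≡ y * c → x ≡ y
*-cancelʳ-invertible x y c c⁻¹ inv eq = begin
  x                ≡⟨ sym (QP.*-identityʳ x) ⟩
  x * 1ℚ           ≡⟨ cong (x *_) (sym inv) ⟩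
  x * (c * c⁻¹)    ≡⟨ sym (QP.*-assoc x c c⁻¹) ⟩
  (x * c) * c⁻¹    ≡⟨ cong (_* c⁻¹) eq ⟩
  (y * c) * c⁻¹    ≡⟨ QP.*-assoc y c c⁻¹ ⟩
  y * (c * c⁻¹)    ≡⟨ cong (y *_) inv ⟩
  y * 1ℚ           ≡⟨ QP.*-identityʳ y ⟩
  y ∎
  where open ≡-Reasoning

-- The recurrence m · 1/m! = 1/(m-1)! for every integer m, under the
-- convention 1/m! = 0 for m < 0 (both sides vanish for m ≤ 0).
invFact-recurrence : ∀ m → intToℚ m * invFact m ≡ invFact (m Z.- + 1)
invFact-recurrence (+ zero)  = QP.*-zeroˡ (invFact (+ zero))
invFact-recurrence -[1+ n ]  = QP.*-zeroʳ (intToℚ -[1+ n ])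
invFact-recurrence (+ suc k) =
  *-cancelʳ-invertible (S * A) B K B
    (trans (QP.*-comm K B) (recip-cancel (k !) {{k !≢0}}))
    (begin
      (S * A) * K   ≡⟨ solve 3 (λ s a c → (s :* a) :* c := a :* (s :* c)) refl S A K ⟩
      A * (S * K)   ≡⟨ cong (A *_) (sym (trans (cong intToℚ (IP.pos-* (suc k) (k !)))
                                               (intToℚ-* (+ suc k) (+ (k !))))) ⟩
      A * intToℚ (+ (suc k !)) ≡⟨ recip-cancel (suc k !) {{suc k !≢0}} ⟩
      1ℚ            ≡⟨ sym (recip-cancel (k !) {{k !≢0}}) ⟩
      B * K ∎)
  where
  open ≡-Reasoning
  S = intToℚ (+ suc k)
  A = invFact (+ suc k)
  B = invFact (+ k)
  K = intToℚ (+ (k !))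

sum-cong : ∀ {n} {f g : Fin n → ℚ} → (∀ i → f i ≡ g i) → sumFin f ≡ sumFin g
sum-cong {zero}  h = refl
sum-cong {suc n} h = cong₂ _+_ (h F.zero) (sum-cong (λ i → h (F.suc i)))

sum-zero : ∀ {n} {f : Fin n → ℚ} → (∀ i → f i ≡ 0ℚ) → sumFin f ≡ 0ℚ
sum-zero {zero}  h = refl
sum-zero {suc n} h = cong₂ _+_ (h F.zero) (sum-zero (λ i → h (F.suc i)))

sum-+ : ∀ {n} (f g : Fin n → ℚ) → sumFin (λ i → f i + g i) ≡ sumFin f + sumFin g
sum-+ {zero}  f g = refl
sum-+ {suc n} f g =
  trans (cong (_+_ (f F.zero + g F.zero)) (sum-+ (λ i → f (F.suc i)) (λ i → g (F.suc i))))
        (solve 4 (λ a b c d → (a :+ b) :+ (c :+ d) := (a :+ c) :+ (b :+ d)) refl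
           (f F.zero) (g F.zero) (sumFin (λ i → f (F.suc i))) (sumFin (λ i → g (F.suc i))))

sum-*ˡ : ∀ {n} (c : ℚ) (f : Fin n → ℚ) → sumFin (λ i → c * f i) ≡ c * sumFin f
sum-*ˡ {zero}  c f = sym (QP.*-zeroʳ c)
sum-*ˡ {suc n} c f =
  trans (cong (_+_ (c * f F.zero)) (sum-*ˡ c (λ i → f (F.suc i))))
        (sym (QP.*-distribˡ-+ c (f F.zero) (sumFin (λ i → f (F.suc i)))))

sum-*ʳ : ∀ {n} (f : Fin n → ℚ) (c : ℚ) → sumFin (λ i → f i * c) ≡ sumFin f * c
sum-*ʳ f c = trans (sum-cong (λ i → QP.*-comm (f i) c))
                   (trans (sum-*ˡ c f) (QP.*-comm c (sumFin f)))

sum-linear : ∀ {n} (s t : ℚ) (f g : Fin n → ℚ) →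
  sumFin (λ i → s * f i + t * g i) ≡ s * sumFin f + t * sumFin g
sum-linear s t f g = trans (sum-+ (λ i → s * f i) (λ i → t * g i)) (cong₂ _+_ (sum-*ˡ s f) (sum-*ˡ t g))

sum-- : ∀ {n} (f g : Fin n → ℚ) → sumFin (λ i → f i - g i) ≡ sumFin f - sumFin g
sum-- f g = begin
  sumFin (λ i → f i - g i)               ≡⟨ sum-cong (λ i → neg-as-scale (f i) (g i)) ⟩
  sumFin (λ i → 1ℚ * f i + (- 1ℚ) * g i) ≡⟨ sum-linear 1ℚ (- 1ℚ) f g ⟩
  1ℚ * sumFin f + (- 1ℚ) * sumFin g     ≡⟨ sym (neg-as-scale (sumFin f) (sumFin g)) ⟩
  sumFin f - sumFin g ∎
  where
  open ≡-Reasoning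
  neg-as-scale : ∀ x y → x - y ≡ 1ℚ * x + (- 1ℚ) * y
  neg-as-scale = solve 2 (λ x y → x :- y := con 1ℚ :* x :+ (:- con 1ℚ) :* y) refl

sum-swap : ∀ {m n} (X : Fin m → Fin n → ℚ) →
  sumFin (λ i → sumFin (λ j → X i j)) ≡ sumFin (λ j → sumFin (λ i → X i j))
sum-swap {zero}  {n} X = sym (sum-zero {n} (λ j → refl))
sum-swap {suc m} X =
  trans (cong (_+_ (sumFin (λ j → X F.zero j))) (sum-swap (λ i j → X (F.suc i) j)))
        (sym (sum-+ (λ j → X F.zero j) (λ j → sumFin (λ i → X (F.suc i) j))))

sum-punchIn : ∀ {n} (p : Fin (suc n)) (g : Fin (suc n) → ℚ) →
  sumFin g ≡ g p + sumFin (λ r → g (punchIn p r))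
sum-punchIn F.zero g = refl
sum-punchIn {suc n} (F.suc p) g =
  trans (cong (_+_ (g F.zero)) (sum-punchIn p (λ r → g (F.suc r))))
        (solve 3 (λ a b c → a :+ (b :+ c) := b :+ (a :+ c)) refl
           (g F.zero) (g (F.suc p)) (sumFin (λ r → g (F.suc (punchIn p r)))))

sum-last : ∀ {n} (g : Fin (suc n) → ℚ) → sumFin g ≡ sumFin (λ r → g (inject₁ r)) + g (fromℕ n)
sum-last {zero}  g = trans (QP.+-identityʳ (g F.zero)) (sym (QP.+-identityˡ (g F.zero)))
sum-last {suc n} g =
  trans (cong (_+_ (g F.zero)) (sum-last (λ r → g (F.suc r))))
        (sym (QP.+-assoc (g F.zero) (sumFin (λ r → g (F.suc (inject₁ r)))) (g (F.suc (fromℕ n)))))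

sign : ∀ {n} → Fin n → ℚ
sign j = signℚ (toℕ j)

minor : ∀ {n} → Matrix (suc n) → Fin (suc n) → Matrix n
minor M j r c = M (F.suc r) (punchIn j c)

term : ∀ {n} → Matrix (suc n) → Fin (suc n) → ℚ
term M j = sign j * (M F.zero j * det (minor M j))

det-cong : ∀ {n} {M N : Matrix n} → (∀ i j → M i j ≡ N i j) → det M ≡ det N
det-cong {zero}  h = refl
det-cong {suc n} h = sum-cong (λ j → cong₂ (λ x y → sign j * (x * y)) (h F.zero j)
                                  (det-cong (λ r c → h (F.suc r) (punchIn j c))))

replaceRow : ∀ {n} → Matrix n → Fin n → (Fin n → ℚ) → Matrix n
replaceRow M k v i j with i F.≟ k
... | yes _ = v j
... | no _  = M i j

replaceCol : ∀ {n} → Matrix n → Fin n → (Fin n → ℚ) → Matrix n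
replaceCol M c u i j with j F.≟ c
... | yes _ = u i
... | no _  = M i j

replaceRow-cong : ∀ {n} (M : Matrix n) k {v v' : Fin n → ℚ} → (∀ j → v j ≡ v' j) →
  det (replaceRow M k v) ≡ det (replaceRow M k v')
replaceRow-cong M k {v} {v'} h = det-cong pointwise
  where
  pointwise : ∀ i j → replaceRow M k v i j ≡ replaceRow M k v' i j
  pointwise i j with i F.≟ k
  ... | yes _ = h j
  ... | no _  = refl

replaceCol-cong : ∀ {n} (M : Matrix n) c {u u' : Fin n → ℚ} → (∀ i → u i ≡ u' i) →
  det (replaceCol M c u) ≡ det (replaceCol M c u')
replaceCol-cong M c {u} {u'} h = det-cong pointwise
  where
  pointwise : ∀ i j → replaceCol M c u i j ≡ replaceCol M c u' i j
  pointwise i j with j F.≟ c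
  ... | yes _ = h i
  ... | no _  = refl

replaceRow-self : ∀ {n} (M : Matrix n) k i j → replaceRow M k (M k) i j ≡ M i j
replaceRow-self M k i j with i F.≟ k
... | yes refl = refl
... | no _     = refl

replaceCol-self : ∀ {n} (M : Matrix n) c i j → replaceCol M c (λ i' → M i' c) i j ≡ M i j
replaceCol-self M c i j with j F.≟ c
... | yes refl = refl
... | no _     = refl

replaceCol-at : ∀ {n} (M : Matrix n) c u i → replaceCol M c u i c ≡ u i
replaceCol-at M c u i with c F.≟ c
... | yes _ = refl
... | no c≢c = ⊥-elim (c≢c refl)

replaceCol-away : ∀ {n} (M : Matrix n) c u i j → j ≢ c → replaceCol M c u i j ≡ M i j
replaceCol-away M c u i j j≢c with j F.≟ c
... | yes j≡c = ⊥-elim (j≢c j≡c)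
... | no _    = refl

det-replaceRow-zero : ∀ {n} (M : Matrix (suc n)) w →
  det (replaceRow M F.zero w) ≡ sumFin (λ j → sign j * (w j * det (minor M j)))
det-replaceRow-zero {n} M w =
  sum-cong (λ j → cong₂ (λ x y → sign j * (x * y)) (top j) (det-cong (λ r c → below r (punchIn j c))))
  where
  top : ∀ j → replaceRow M F.zero w F.zero j ≡ w j
  top j with F._≟_ {suc n} F.zero F.zero
  ... | yes _ = refl
  ... | no 0≢0 = ⊥-elim (0≢0 refl)
  below : ∀ r j → replaceRow M F.zero w (F.suc r) j ≡ M (F.suc r) j
  below r j with F.suc r F.≟ F.zero
  ... | no _ = refl

-- Replacing row k+1 only affects the minors, where it becomes row k.
det-replaceRow-suc : ∀ {n} (M : Matrix (suc n)) k w →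
  det (replaceRow M (F.suc k) w) ≡
  sumFin (λ j → sign j * (M F.zero j * det (replaceRow (minor M j) k (λ c → w (punchIn j c)))))
det-replaceRow-suc M k w =
  sum-cong (λ j → cong₂ (λ x y → sign j * (x * y)) (top j) (det-cong (minor-replaced j)))
  where
  top : ∀ j → replaceRow M (F.suc k) w F.zero j ≡ M F.zero j
  top j with F.zero F.≟ F.suc k
  ... | no _ = refl
  minor-replaced : ∀ j r c →
    minor (replaceRow M (F.suc k) w) j r c ≡ replaceRow (minor M j) k (λ c' → w (punchIn j c')) r c
  minor-replaced j r c with F.suc r F.≟ F.suc k | r F.≟ k
  ... | yes _ | yes _ = refl
  ... | yes p | no q  = ⊥-elim (q (FP.suc-injective p))
  ... | no p  | yes q = ⊥-elim (p (cong F.suc q))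
  ... | no _  | no _  = refl

private
  lin-inner : ∀ σ s t x y d → σ * ((s * x + t * y) * d) ≡ s * (σ * (x * d)) + t * (σ * (y * d))
  lin-inner = solve 6 (λ σ s t x y d →
    σ :* ((s :* x :+ t :* y) :* d) := s :* (σ :* (x :* d)) :+ t :* (σ :* (y :* d))) refl

  lin-outer : ∀ σ m s t x y → σ * (m * (s * x + t * y)) ≡ s * (σ * (m * x)) + t * (σ * (m * y))
  lin-outer = solve 6 (λ σ m s t x y →
    σ :* (m :* (s :* x :+ t :* y)) := s :* (σ :* (m :* x)) :+ t :* (σ :* (m :* y))) refl

det-linear-row : ∀ {n} (M : Matrix n) k (s t : ℚ) (v u : Fin n → ℚ) →
  det (replaceRow M k (λ j → s * v j + t * u j)) ≡ s * det (replaceRow M k v) + t * det (replaceRow M k u)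
det-linear-row {suc n} M F.zero s t v u = begin
  det (replaceRow M F.zero (λ j → s * v j + t * u j))
    ≡⟨ det-replaceRow-zero M (λ j → s * v j + t * u j) ⟩
  sumFin (λ j → sign j * ((s * v j + t * u j) * det (minor M j)))
    ≡⟨ sum-cong (λ j → lin-inner (sign j) s t (v j) (u j) (det (minor M j))) ⟩
  sumFin (λ j → s * (sign j * (v j * det (minor M j))) + t * (sign j * (u j * det (minor M j))))
    ≡⟨ sum-linear s t (λ j → sign j * (v j * det (minor M j))) (λ j → sign j * (u j * det (minor M j))) ⟩
  s * sumFin (λ j → sign j * (v j * det (minor M j))) + t * sumFin (λ j → sign j * (u j * det (minor M j)))
    ≡⟨ sym (cong₂ (λ x y → s * x + t * y) (det-replaceRow-zero M v) (det-replaceRow-zero M u)) ⟩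
  s * det (replaceRow M F.zero v) + t * det (replaceRow M F.zero u) ∎
  where open ≡-Reasoning
det-linear-row {suc n} M (F.suc k) s t v u = begin
  det (replaceRow M (F.suc k) (λ j → s * v j + t * u j))
    ≡⟨ det-replaceRow-suc M k (λ j → s * v j + t * u j) ⟩
  sumFin (λ j → sign j * (M F.zero j * det (replaceRow (minor M j) k (λ c → s * v (punchIn j c) + t * u (punchIn j c)))))
    ≡⟨ sum-cong (λ j → trans (cong (λ z → sign j * (M F.zero j * z))
                                   (det-linear-row (minor M j) k s t (λ c → v (punchIn j c)) (λ c → u (punchIn j c))))
                             (lin-outer (sign j) (M F.zero j) s t (V j) (U j))) ⟩
  sumFin (λ j → s * (sign j * (M F.zero j * V j)) + t * (sign j * (M F.zero j * U j)))
    ≡⟨ sum-linear s t (λ j → sign j * (M F.zero j * V j)) (λ j → sign j * (M F.zero j * U j)) ⟩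
  s * sumFin (λ j → sign j * (M F.zero j * V j)) + t * sumFin (λ j → sign j * (M F.zero j * U j))
    ≡⟨ sym (cong₂ (λ x y → s * x + t * y) (det-replaceRow-suc M k v) (det-replaceRow-suc M k u)) ⟩
  s * det (replaceRow M (F.suc k) v) + t * det (replaceRow M (F.suc k) u) ∎
  where
  open ≡-Reasoning
  V = λ j → det (replaceRow (minor M j) k (λ c → v (punchIn j c)))
  U = λ j → det (replaceRow (minor M j) k (λ c → u (punchIn j c)))

term-replaceCol-at : ∀ {n} (M : Matrix (suc n)) c u →
  term (replaceCol M c u) c ≡ sign c * (u F.zero * det (minor M c))
term-replaceCol-at M c u =
  cong₂ (λ x y → sign c * (x * y)) (replaceCol-at M c u F.zero) (det-cong minor-unchanged)
  where
  minor-unchanged : ∀ r s → minor (replaceCol M c u) c r s ≡ minor M c r s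
  minor-unchanged r s = replaceCol-away M c u (F.suc r) (punchIn c s) (FP.punchInᵢ≢i c s)

-- The term at any other column j: in the minor for j, column punchIn j c'
-- becomes column c'.
term-replaceCol-away : ∀ {n} (M : Matrix (suc n)) j c' u →
  term (replaceCol M (punchIn j c') u) j ≡
  sign j * (M F.zero j * det (replaceCol (minor M j) c' (λ r → u (F.suc r))))
term-replaceCol-away M j c' u =
  cong₂ (λ x y → sign j * (x * y))
    (replaceCol-away M (punchIn j c') u F.zero j (λ e → FP.punchInᵢ≢i j c' (sym e)))
    (det-cong minor-replaced)
  where
  minor-replaced : ∀ r s →
    minor (replaceCol M (punchIn j c') u) j r s ≡ replaceCol (minor M j) c' (λ r' → u (F.suc r')) r s
  minor-replaced r s with punchIn j s F.≟ punchIn j c' | s F.≟ c'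
  ... | yes _ | yes _ = refl
  ... | yes p | no q  = ⊥-elim (q (FP.punchIn-injective j s c' p))
  ... | no p  | yes q = ⊥-elim (p (cong (punchIn j) q))
  ... | no _  | no _  = refl

det-replaceCol-expand : ∀ {n} (M : Matrix (suc n)) c u →
  det (replaceCol M c u) ≡ sign c * (u F.zero * det (minor M c))
     + sumFin (λ r → sign (punchIn c r) * (M F.zero (punchIn c r) *
         det (replaceCol (minor M (punchIn c r)) (punchOut (FP.punchInᵢ≢i c r)) (λ r' → u (F.suc r')))))
det-replaceCol-expand M c u =
  trans (sum-punchIn c (term (replaceCol M c u)))
        (cong₂ _+_ (term-replaceCol-at M c u) (sum-cong other))
  where
  other : ∀ r → term (replaceCol M c u) (punchIn c r) ≡
    sign (punchIn c r) * (M F.zero (punchIn c r) *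
      det (replaceCol (minor M (punchIn c r)) (punchOut (FP.punchInᵢ≢i c r)) (λ r' → u (F.suc r'))))
  other r = away (punchIn c r) c (punchOut (FP.punchInᵢ≢i c r)) (FP.punchIn-punchOut (FP.punchInᵢ≢i c r))
    where
    away : ∀ j c₀ c' → punchIn j c' ≡ c₀ →
      term (replaceCol M c₀ u) j ≡ sign j * (M F.zero j * det (replaceCol (minor M j) c' (λ r' → u (F.suc r'))))
    away j .(punchIn j c') c' refl = term-replaceCol-away M j c' u

det-linear-col : ∀ {n} (M : Matrix n) c (s t : ℚ) (v u : Fin n → ℚ) →
  det (replaceCol M c (λ i → s * v i + t * u i)) ≡ s * det (replaceCol M c v) + t * det (replaceCol M c u)
det-linear-col {suc n} M c s t v u = begin
  det (replaceCol M c w) ≡⟨ det-replaceCol-expand M c w ⟩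
  sign c * (w F.zero * det (minor M c))
    + sumFin (λ r → sign (p r) * (M F.zero (p r) * det (replaceCol (minor M (p r)) (q r) (λ r' → w (F.suc r')))))
    ≡⟨ cong₂ _+_ (lin-inner (sign c) s t (v F.zero) (u F.zero) (det (minor M c)))
         (trans (sum-cong (λ r → trans (cong (λ z → sign (p r) * (M F.zero (p r) * z))
                                              (det-linear-col (minor M (p r)) (q r) s t (λ r' → v (F.suc r')) (λ r' → u (F.suc r'))))
                                        (lin-outer (sign (p r)) (M F.zero (p r)) s t (V r) (U r))))
                (sum-linear s t (λ r → sign (p r) * (M F.zero (p r) * V r)) (λ r → sign (p r) * (M F.zero (p r) * U r)))) ⟩
  (s * (sign c * (v F.zero * det (minor M c))) + t * (sign c * (u F.zero * det (minor M c))))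
   + (s * sumFin (λ r → sign (p r) * (M F.zero (p r) * V r)) + t * sumFin (λ r → sign (p r) * (M F.zero (p r) * U r)))
    ≡⟨ regroup s t _ _ _ _ ⟩
  s * (sign c * (v F.zero * det (minor M c)) + sumFin (λ r → sign (p r) * (M F.zero (p r) * V r)))
   + t * (sign c * (u F.zero * det (minor M c)) + sumFin (λ r → sign (p r) * (M F.zero (p r) * U r)))
    ≡⟨ sym (cong₂ (λ x y → s * x + t * y) (det-replaceCol-expand M c v) (det-replaceCol-expand M c u)) ⟩
  s * det (replaceCol M c v) + t * det (replaceCol M c u) ∎
  where
  open ≡-Reasoning
  w = λ i → s * v i + t * u i
  p = λ r → punchIn c r
  q = λ r → punchOut (FP.punchInᵢ≢i c r)
  V = λ r → det (replaceCol (minor M (p r)) (q r) (λ r' → v (F.suc r')))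
  U = λ r → det (replaceCol (minor M (p r)) (q r) (λ r' → u (F.suc r')))
  regroup : ∀ s t a b c d → (s * a + t * b) + (s * c + t * d) ≡ s * (a + c) + t * (b + d)
  regroup = solve 6 (λ s t a b c d → (s :* a :+ t :* b) :+ (s :* c :+ t :* d) := s :* (a :+ c) :+ t :* (b :+ d)) refl

private
  as-combination : ∀ t x → t * x ≡ t * x + 0ℚ * x
  as-combination = solve 2 (λ t x → t :* x := t :* x :+ con 0ℚ :* x) refl

  drop-zero-part : ∀ t d → t * d + 0ℚ * d ≡ t * d
  drop-zero-part = solve 2 (λ t d → t :* d :+ con 0ℚ :* d := t :* d) refl

det-scale-row : ∀ {n} (M : Matrix n) k t → det (replaceRow M k (λ j → t * M k j)) ≡ t * det M
det-scale-row M k t = begin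
  det (replaceRow M k (λ j → t * M k j))           ≡⟨ replaceRow-cong M k (λ j → as-combination t (M k j)) ⟩
  det (replaceRow M k (λ j → t * M k j + 0ℚ * M k j)) ≡⟨ det-linear-row M k t 0ℚ (M k) (M k) ⟩
  t * det (replaceRow M k (M k)) + 0ℚ * det (replaceRow M k (M k)) ≡⟨ drop-zero-part t _ ⟩
  t * det (replaceRow M k (M k))                   ≡⟨ cong (t *_) (det-cong (replaceRow-self M k)) ⟩
  t * det M ∎
  where open ≡-Reasoning

det-scale-col : ∀ {n} (M : Matrix n) c t → det (replaceCol M c (λ i → t * M i c)) ≡ t * det M
det-scale-col M c t = begin
  det (replaceCol M c (λ i → t * M i c))           ≡⟨ replaceCol-cong M c (λ i → as-combination t (M i c)) ⟩
  det (replaceCol M c (λ i → t * M i c + 0ℚ * M i c)) ≡⟨ det-linear-col M c t 0ℚ (λ i → M i c) (λ i → M i c) ⟩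
  t * det (replaceCol M c (λ i → M i c)) + 0ℚ * det (replaceCol M c (λ i → M i c)) ≡⟨ drop-zero-part t _ ⟩
  t * det (replaceCol M c (λ i → M i c))           ≡⟨ cong (t *_) (det-cong (replaceCol-self M c)) ⟩
  t * det M ∎
  where open ≡-Reasoning

det-additive-row : ∀ {n} (M : Matrix n) k (v u : Fin n → ℚ) →
  det (replaceRow M k (λ j → v j + u j)) ≡ det (replaceRow M k v) + det (replaceRow M k u)
det-additive-row M k v u = begin
  det (replaceRow M k (λ j → v j + u j))          ≡⟨ replaceRow-cong M k (λ j → unit-weights (v j) (u j)) ⟩
  det (replaceRow M k (λ j → 1ℚ * v j + 1ℚ * u j)) ≡⟨ det-linear-row M k 1ℚ 1ℚ v u ⟩
  1ℚ * det (replaceRow M k v) + 1ℚ * det (replaceRow M k u) ≡⟨ sym (unit-weights (det (replaceRow M k v)) (det (replaceRow M k u))) ⟩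
  det (replaceRow M k v) + det (replaceRow M k u) ∎
  where
  open ≡-Reasoning
  unit-weights : ∀ x y → x + y ≡ 1ℚ * x + 1ℚ * y
  unit-weights = solve 2 (λ x y → x :+ y := con 1ℚ :* x :+ con 1ℚ :* y) refl

-- Σₖ det(M with row k replaced by row k of N), and the column analogue.
-- Both are the derivative of t ↦ det(M + tN) at 0, hence equal.
rowReplacementSum : ∀ {n} → Matrix n → Matrix n → ℚ
rowReplacementSum M N = sumFin (λ k → det (replaceRow M k (N k)))

colReplacementSum : ∀ {n} → Matrix n → Matrix n → ℚ
colReplacementSum M N = sumFin (λ c → det (replaceCol M c (λ i → N i c)))

private
  sum-*ˡ² : ∀ {n} (a b : ℚ) (f : Fin n → ℚ) → sumFin (λ i → a * (b * f i)) ≡ a * (b * sumFin f)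
  sum-*ˡ² a b f = trans (sum-*ˡ a (λ i → b * f i)) (cong (a *_) (sum-*ˡ b f))

-- Induction on n: expanding along row 0, both sums become the row-0 term for
-- N plus the replacement sums of the minors, which agree by induction.
row≡col-replacementSum : ∀ {n} (M N : Matrix n) → rowReplacementSum M N ≡ colReplacementSum M N
row≡col-replacementSum {zero}  M N = refl
row≡col-replacementSum {suc m} M N = begin
  rowReplacementSum M N
    ≡⟨ cong₂ _+_ (det-replaceRow-zero M (N F.zero)) (sum-cong (λ k → det-replaceRow-suc M k (N (F.suc k)))) ⟩
  A + sumFin (λ k → sumFin (λ j → sign j * (M F.zero j * R k j)))
    ≡⟨ cong (_+_ A) (sum-swap (λ k j → sign j * (M F.zero j * R k j))) ⟩
  A + sumFin (λ j → sumFin (λ k → sign j * (M F.zero j * R k j)))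
    ≡⟨ cong (_+_ A) (sum-cong (λ j → sum-*ˡ² (sign j) (M F.zero j) (λ k → R k j))) ⟩
  A + sumFin (λ j → sign j * (M F.zero j * rowReplacementSum (minor M j) (minor N j)))
    ≡⟨ cong (_+_ A) (sum-cong (λ j → cong (λ z → sign j * (M F.zero j * z))
                                      (row≡col-replacementSum (minor M j) (minor N j)))) ⟩
  A + sumFin (λ j → sign j * (M F.zero j * colReplacementSum (minor M j) (minor N j)))
    ≡⟨ sym (sum-+ (λ j → sign j * (N F.zero j * det (minor M j)))
                  (λ j → sign j * (M F.zero j * colReplacementSum (minor M j) (minor N j)))) ⟩
  sumFin (λ j → sign j * (N F.zero j * det (minor M j)) + sign j * (M F.zero j * colReplacementSum (minor M j) (minor N j)))
    ≡⟨ sym (sum-cong column-term) ⟩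
  sumFin (λ j → sumFin (λ c → term (replaceCol M c (λ i → N i c)) j))
    ≡⟨ sym (sum-swap (λ c j → term (replaceCol M c (λ i → N i c)) j)) ⟩
  colReplacementSum M N ∎
  where
  open ≡-Reasoning
  A = sumFin (λ j → sign j * (N F.zero j * det (minor M j)))
  R = λ k j → det (replaceRow (minor M j) k (λ c → N (F.suc k) (punchIn j c)))
  column-term : ∀ j → sumFin (λ c → term (replaceCol M c (λ i → N i c)) j) ≡
    sign j * (N F.zero j * det (minor M j)) + sign j * (M F.zero j * colReplacementSum (minor M j) (minor N j))
  column-term j =
    trans (sum-punchIn j (λ c → term (replaceCol M c (λ i → N i c)) j))
          (cong₂ _+_ (term-replaceCol-at M j (λ i → N i j))
                     (trans (sum-cong (λ c' → term-replaceCol-away M j c' (λ i → N i (punchIn j c'))))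
                            (sum-*ˡ² (sign j) (M F.zero j)
                               (λ c' → det (replaceCol (minor M j) c' (λ r → N (F.suc r) (punchIn j c')))))))

-- Expanding along
-- row 0, the terms at columns c and c+1 have the same minor and opposite
-- signs, and every other term has a minor that again has two equal adjacent
-- columns.

delete-adjacent : ∀ {n} (f : Fin (suc n) → ℚ) (c : Fin n) → f (inject₁ c) ≡ f (F.suc c) →
  ∀ s → f (punchIn (inject₁ c) s) ≡ f (punchIn (F.suc c) s)
delete-adjacent f F.zero    h F.zero    = sym h
delete-adjacent f F.zero    h (F.suc s) = refl
delete-adjacent f (F.suc c) h F.zero    = refl
delete-adjacent f (F.suc c) h (F.suc s) = delete-adjacent (λ x → f (F.suc x)) c h s

punchIn-inject₁-self : ∀ {n} (c : Fin n) → punchIn (inject₁ c) c ≡ F.suc c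
punchIn-inject₁-self F.zero    = refl
punchIn-inject₁-self (F.suc c) = cong F.suc (punchIn-inject₁-self c)

adjacent-after-delete : ∀ {n} (c : Fin (suc n)) (s : Fin n) → Σ (Fin n) λ c'' →
  (punchIn (punchIn (inject₁ c) (punchIn c s)) (inject₁ c'') ≡ inject₁ c) ×
  (punchIn (punchIn (inject₁ c) (punchIn c s)) (F.suc c'') ≡ F.suc c)
adjacent-after-delete {suc n} F.zero    s      = F.zero , refl , refl
adjacent-after-delete {suc n} (F.suc c) F.zero = c , refl , refl
adjacent-after-delete {suc n} (F.suc c) (F.suc s) with adjacent-after-delete c s
... | c'' , e₁ , e₂ = F.suc c'' , cong F.suc e₁ , cong F.suc e₂

det-adjacent-cols : ∀ {n} (M : Matrix (suc n)) (c : Fin n) →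
  (∀ i → M i (inject₁ c) ≡ M i (F.suc c)) → det M ≡ 0ℚ
det-adjacent-cols {suc n} M c h = begin
  det M
    ≡⟨ sum-punchIn p (term M) ⟩
  term M p + sumFin (λ r → term M (punchIn p r))
    ≡⟨ cong (_+_ (term M p)) (sum-punchIn c (λ r → term M (punchIn p r))) ⟩
  term M p + (term M (punchIn p c) + sumFin (λ s → term M (punchIn p (punchIn c s))))
    ≡⟨ cong (λ z → term M p + (term M (punchIn p c) + z)) (sum-zero other-terms-vanish) ⟩
  term M p + (term M (punchIn p c) + 0ℚ)
    ≡⟨ cong (_+_ (term M p)) (trans (QP.+-identityʳ _) (cong (term M) (punchIn-inject₁-self c))) ⟩
  term M p + term M (F.suc c)
    ≡⟨ cong₂ (λ x y → x + (- signℚ (toℕ c)) * y)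
             (cong (_* (M F.zero p * det (minor M p))) (cong signℚ (FP.toℕ-inject₁ c)))
             (sym (cong₂ _*_ (h F.zero) (det-cong (λ r s → delete-adjacent (M (F.suc r)) c (h (F.suc r)) s)))) ⟩
  signℚ (toℕ c) * T + (- signℚ (toℕ c)) * T
    ≡⟨ solve 2 (λ σ t → σ :* t :+ (:- σ) :* t := con 0ℚ) refl (signℚ (toℕ c)) T ⟩
  0ℚ ∎
  where
  open ≡-Reasoning
  p = inject₁ c
  T = M F.zero p * det (minor M p)
  other-terms-vanish : ∀ s → term M (punchIn p (punchIn c s)) ≡ 0ℚ
  other-terms-vanish s with adjacent-after-delete c s
  ... | c'' , e₁ , e₂ =
    trans (cong (λ z → sign j * (M F.zero j * z))
                (det-adjacent-cols (minor M j) c''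
                  (λ r → trans (cong (M (F.suc r)) e₁) (trans (h (F.suc r)) (cong (M (F.suc r)) (sym e₂))))))
          (solve 2 (λ σ x → σ :* (x :* con 0ℚ) := con 0ℚ) refl (sign j) (M F.zero j))
    where j = punchIn p (punchIn c s)

module Computation (m : ℕ) (a : Fin (suc m) → ℕ) where

  M : Matrix (suc m)
  M = matM a

  D : ℚ
  D = det M

  -- Xᵢ = aᵢ and Jⱼ = j (indices are 1-based in the statement).
  X : Fin (suc m) → ℚ
  X i = intToℚ (+ a i)

  J : Fin (suc m) → ℚ
  J j = intToℚ (+ suc (toℕ j))

  shifted : Fin (suc m) → Fin (suc m) → ℚ
  shifted i j = invFact (diff a i j Z.- + 1)

  last : Fin (suc m)
  last = fromℕ m

  -- The one column replacement that does not collapse.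
  G : ℚ
  G = det (replaceCol M last (λ i → shifted i last))

  diff-as-ℚ : ∀ i j → intToℚ (diff a i j) ≡ X i - J j
  diff-as-ℚ i j = intToℚ-- (+ a i) (+ suc (toℕ j))

  -- Xᵢ·Mᵢⱼ = (aᵢ-j)/(aᵢ-j)! + j/(aᵢ-j)! = 1/(aᵢ-j-1)! + Jⱼ·Mᵢⱼ.
  factorial-step : ∀ i j → X i * M i j ≡ shifted i j + J j * M i j
  factorial-step i j = begin
    X i * M i j                         ≡⟨ solve 3 (λ x y f → x :* f := (x :- y) :* f :+ y :* f) refl (X i) (J j) (M i j) ⟩
    (X i - J j) * M i j + J j * M i j   ≡⟨ cong (λ z → z * M i j + J j * M i j) (sym (diff-as-ℚ i j)) ⟩
    intToℚ (diff a i j) * M i j + J j * M i j ≡⟨ cong (_+ J j * M i j) (invFact-recurrence (diff a i j)) ⟩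
    shifted i j + J j * M i j ∎
    where open ≡-Reasoning

  shifted-is-next-column : ∀ i (c : Fin m) → shifted i (inject₁ c) ≡ M i (F.suc c)
  shifted-is-next-column i c = cong invFact (begin
    (+ a i Z.- + suc (toℕ (inject₁ c))) Z.- + 1 ≡⟨ cong (λ t → (+ a i Z.- + suc t) Z.- + 1) (FP.toℕ-inject₁ c) ⟩
    (+ a i Z.- + suc (toℕ c)) Z.- + 1          ≡⟨ IP.+-assoc (+ a i) -[1+ toℕ c ] -[1+ 0 ] ⟩
    + a i Z.+ -[1+ suc (toℕ c N.+ 0) ]          ≡⟨ cong (λ t → + a i Z.+ -[1+ suc t ]) (NP.+-identityʳ (toℕ c)) ⟩
    + a i Z.- + suc (suc (toℕ c)) ∎)
    where open ≡-Reasoning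

  -- Replacing a non-last column by its shift duplicates the next column.
  shifted-replacement-vanishes : ∀ (c : Fin m) →
    det (replaceCol M (inject₁ c) (λ i → shifted i (inject₁ c))) ≡ 0ℚ
  shifted-replacement-vanishes c = det-adjacent-cols (replaceCol M (inject₁ c) u) c (λ i →
    trans (replaceCol-at M (inject₁ c) u i)
          (trans (shifted-is-next-column i c) (sym (replaceCol-away M (inject₁ c) u i (F.suc c) next≢c))))
    where
    u = λ i → shifted i (inject₁ c)
    next≢c : F.suc c ≢ inject₁ c
    next≢c e = NP.1+n≢n (trans (cong toℕ e) (FP.toℕ-inject₁ c))

  weighted-col-sum : ∀ (w : Fin (suc m) → ℚ) →
    sumFin (λ c → det (replaceCol M c (λ i → w c * (X i * M i c)))) ≡ w last * G + sumFin (λ c → (w c * J c) * D)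
  weighted-col-sum w = begin
    sumFin (λ c → det (replaceCol M c (λ i → w c * (X i * M i c))))
      ≡⟨ sum-cong (λ c → trans (replaceCol-cong M c (λ i → entry c i))
                               (trans (det-linear-col M c (w c) (w c * J c) (λ i → shifted i c) (λ i → M i c))
                                      (cong (λ z → w c * H c + (w c * J c) * z) (det-cong (replaceCol-self M c))))) ⟩
    sumFin (λ c → w c * H c + (w c * J c) * D)
      ≡⟨ sum-+ (λ c → w c * H c) (λ c → (w c * J c) * D) ⟩
    sumFin (λ c → w c * H c) + sumFin (λ c → (w c * J c) * D)
      ≡⟨ cong (_+ sumFin (λ c → (w c * J c) * D)) only-last ⟩
    w last * G + sumFin (λ c → (w c * J c) * D) ∎
    where
    open ≡-Reasoning
    H : Fin (suc m) → ℚ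
    H c = det (replaceCol M c (λ i → shifted i c))
    entry : ∀ c i → w c * (X i * M i c) ≡ w c * shifted i c + (w c * J c) * M i c
    entry c i = trans (cong (w c *_) (factorial-step i c))
                      (solve 4 (λ w p j f → w :* (p :+ j :* f) := w :* p :+ (w :* j) :* f) refl
                             (w c) (shifted i c) (J c) (M i c))
    only-last : sumFin (λ c → w c * H c) ≡ w last * G
    only-last = begin
      sumFin (λ c → w c * H c)                                   ≡⟨ sum-last (λ c → w c * H c) ⟩
      sumFin (λ c → w (inject₁ c) * H (inject₁ c)) + w last * G
        ≡⟨ cong (_+ w last * G) (sum-zero (λ c → trans (cong (w (inject₁ c) *_) (shifted-replacement-vanishes c))
                                                       (QP.*-zeroʳ (w (inject₁ c))))) ⟩
      0ℚ + w last * G                                            ≡⟨ QP.+-identityˡ (w last * G) ⟩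
      w last * G ∎

  -- With all weights 1, scaling rows instead of columns determines G.
  G-value : G ≡ sumFin (λ k → X k * D) - sumFin (λ k → J k * D)
  G-value = begin
    G ≡⟨ solve 2 (λ g y → g := (con 1ℚ :* g :+ y) :- y) refl G ΣJ ⟩
    (1ℚ * G + ΣJ) - ΣJ                   ≡⟨ cong (_- ΣJ) (sym X-sum) ⟩
    sumFin (λ k → X k * D) - ΣJ ∎
    where
    open ≡-Reasoning
    ΣJ = sumFin (λ k → J k * D)
    X-sum : sumFin (λ k → X k * D) ≡ 1ℚ * G + ΣJ
    X-sum = begin
      sumFin (λ k → X k * D)                     ≡⟨ sum-cong (λ k → sym (det-scale-row M k (X k))) ⟩
      rowReplacementSum M (λ i j → X i * M i j)  ≡⟨ row≡col-replacementSum M (λ i j → X i * M i j) ⟩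
      colReplacementSum M (λ i j → X i * M i j)
        ≡⟨ sum-cong (λ c → replaceCol-cong M c (λ i → sym (QP.*-identityˡ (X i * M i c)))) ⟩
      sumFin (λ c → det (replaceCol M c (λ i → 1ℚ * (X i * M i c)))) ≡⟨ weighted-col-sum (λ _ → 1ℚ) ⟩
      1ℚ * G + sumFin (λ c → (1ℚ * J c) * D)    ≡⟨ cong (_+_ (1ℚ * G)) (sum-cong (λ c → cong (_* D) (QP.*-identityˡ (J c)))) ⟩
      1ℚ * G + ΣJ ∎

  -- The linear-in-Xₖ part of (aₖ-j)(aₖ-j-1) has weight wⱼ = -(2Jⱼ+1).
  w : Fin (suc m) → ℚ
  w j = - (J j + J j + 1ℚ)

  linearPart constantPart : Matrix (suc m)
  linearPart k j = w j * (X k * M k j)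
  constantPart k j = (J j * (J j + 1ℚ)) * M k j

  row-entry : ∀ k j → intToℚ (diff a k j Z.* (diff a k j Z.- + 1)) * M k j ≡
    (X k * X k) * M k j + (linearPart k j + constantPart k j)
  row-entry k j = begin
    intToℚ (diff a k j Z.* (diff a k j Z.- + 1)) * M k j
      ≡⟨ cong (_* M k j) (trans (intToℚ-* (diff a k j) (diff a k j Z.- + 1))
                                (cong (intToℚ (diff a k j) *_) (intToℚ-- (diff a k j) (+ 1)))) ⟩
    (intToℚ (diff a k j) * (intToℚ (diff a k j) - 1ℚ)) * M k j
      ≡⟨ cong (λ z → (z * (z - 1ℚ)) * M k j) (diff-as-ℚ k j) ⟩
    ((X k - J j) * ((X k - J j) - 1ℚ)) * M k j
      ≡⟨ solve 3 (λ x y f → ((x :- y) :* ((x :- y) :- con 1ℚ)) :* f :=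
                   (x :* x) :* f :+ ((:- (y :+ y :+ con 1ℚ)) :* (x :* f) :+ (y :* (y :+ con 1ℚ)) :* f))
               refl (X k) (J j) (M k j) ⟩
    (X k * X k) * M k j + (linearPart k j + constantPart k j) ∎
    where open ≡-Reasoning

  -- M⁽ᵏ⁾ is M with row k replaced, so linearity in row k splits det M⁽ᵏ⁾.
  det-Mk : ∀ k → det (matMk a k) ≡
    (X k * X k) * D + (det (replaceRow M k (linearPart k)) + det (replaceRow M k (constantPart k)))
  det-Mk k = begin
    det (matMk a k)
      ≡⟨ det-cong Mk-as-replacement ⟩
    det (replaceRow M k (λ j → intToℚ (diff a k j Z.* (diff a k j Z.- + 1)) * M k j))
      ≡⟨ replaceRow-cong M k (row-entry k) ⟩
    det (replaceRow M k (λ j → (X k * X k) * M k j + (linearPart k j + constantPart k j)))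
      ≡⟨ det-additive-row M k (λ j → (X k * X k) * M k j) (λ j → linearPart k j + constantPart k j) ⟩
    det (replaceRow M k (λ j → (X k * X k) * M k j)) + det (replaceRow M k (λ j → linearPart k j + constantPart k j))
      ≡⟨ cong₂ _+_ (det-scale-row M k (X k * X k)) (det-additive-row M k (linearPart k) (constantPart k)) ⟩
    (X k * X k) * D + (det (replaceRow M k (linearPart k)) + det (replaceRow M k (constantPart k))) ∎
    where
    open ≡-Reasoning
    Mk-as-replacement : ∀ i j →
      matMk a k i j ≡ replaceRow M k (λ j' → intToℚ (diff a k j' Z.* (diff a k j' Z.- + 1)) * M k j') i j
    Mk-as-replacement i j with i F.≟ k
    ... | yes refl = refl
    ... | no _     = refl

  linearPart-sum : rowReplacementSum M linearPart ≡ w last * G + sumFin (λ c → (w c * J c) * D)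
  linearPart-sum = trans (row≡col-replacementSum M linearPart) (weighted-col-sum w)

  constantPart-sum : rowReplacementSum M constantPart ≡ sumFin (λ c → (J c * (J c + 1ℚ)) * D)
  constantPart-sum = trans (row≡col-replacementSum M constantPart)
                           (sum-cong (λ c → det-scale-col M c (J c * (J c + 1ℚ))))

  N : ℚ
  N = intToℚ (+ suc m)

  w-last : w last ≡ - (N + N + 1ℚ)
  w-last = cong (λ z → - (z + z + 1ℚ)) (cong (λ t → intToℚ (+ suc t)) (FP.toℕ-fromℕ m))

  summand : Fin (suc m) → ℚ
  summand k = (X k - J k) * (((X k - (N + N)) + J k) - 1ℚ)

  coeff-as-ℚ : intToℚ (coeff (suc m) a) ≡ sumFin summand
  coeff-as-ℚ = trans (intToℚ-sum summandℤ) (sum-cong summand-as-ℚ)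
    where
    summandℤ : Fin (suc m) → ℤ
    summandℤ k = (+ a k Z.- + suc (toℕ k)) Z.* (+ a k Z.- + (2 N.* suc m) Z.+ + suc (toℕ k) Z.- + 1)
    two-n : intToℚ (+ (2 N.* suc m)) ≡ N + N
    two-n = trans (cong intToℚ (trans (cong (λ t → + (suc m N.+ t)) (NP.+-identityʳ (suc m)))
                                      (IP.pos-+ (suc m) (suc m))))
                  (intToℚ-+ (+ suc m) (+ suc m))
    summand-as-ℚ : ∀ k → intToℚ (summandℤ k) ≡ summand k
    summand-as-ℚ k =
      trans (intToℚ-* (diff a k k) (+ a k Z.- + (2 N.* suc m) Z.+ + suc (toℕ k) Z.- + 1))
        (cong₂ _*_ (diff-as-ℚ k k)
          (trans (intToℚ-- (+ a k Z.- + (2 N.* suc m) Z.+ + suc (toℕ k)) (+ 1))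
            (cong (_- 1ℚ) (trans (intToℚ-+ (+ a k Z.- + (2 N.* suc m)) (+ suc (toℕ k)))
              (cong (_+ J k) (trans (intToℚ-- (+ a k) (+ (2 N.* suc m))) (cong (_-_ (X k)) two-n)))))))

  sum-det-Mk : sumFin (λ k → det (matMk a k)) ≡ sumFin (λ k → summand k * D)
  sum-det-Mk = begin
    sumFin (λ k → det (matMk a k))
      ≡⟨ sum-cong det-Mk ⟩
    sumFin (λ k → (X k * X k) * D + (det (replaceRow M k (linearPart k)) + det (replaceRow M k (constantPart k))))
      ≡⟨ trans (sum-+ (λ k → (X k * X k) * D) (λ k → detL k + detC k)) (cong (_+_ ΣX²) (sum-+ detL detC)) ⟩
    ΣX² + (rowReplacementSum M linearPart + rowReplacementSum M constantPart)
      ≡⟨ cong₂ (λ x y → ΣX² + (x + y)) linearPart-sum constantPart-sum ⟩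
    ΣX² + ((w last * G + ΣwJ) + ΣJJ)
      ≡⟨ cong₂ (λ x y → ΣX² + ((x * y + ΣwJ) + ΣJJ)) w-last G-value ⟩
    ΣX² + ((W * (ΣX - ΣJ) + ΣwJ) + ΣJJ)
      ≡⟨ sym collect ⟩
    sumFin (λ k → (X k * X k) * D + ((W * (X k * D - J k * D) + (w k * J k) * D) + (J k * (J k + 1ℚ)) * D))
      ≡⟨ sum-cong (λ k → sym (per-index (X k) (J k) N D)) ⟩
    sumFin (λ k → summand k * D) ∎
    where
    open ≡-Reasoning
    W = - (N + N + 1ℚ)
    ΣX² = sumFin (λ k → (X k * X k) * D)
    ΣX  = sumFin (λ k → X k * D)
    ΣJ  = sumFin (λ k → J k * D)
    ΣwJ = sumFin (λ c → (w c * J c) * D)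
    ΣJJ = sumFin (λ c → (J c * (J c + 1ℚ)) * D)
    detL detC : Fin (suc m) → ℚ
    detL k = det (replaceRow M k (linearPart k))
    detC k = det (replaceRow M k (constantPart k))
    collect : sumFin (λ k → (X k * X k) * D + ((W * (X k * D - J k * D) + (w k * J k) * D) + (J k * (J k + 1ℚ)) * D))
              ≡ ΣX² + ((W * (ΣX - ΣJ) + ΣwJ) + ΣJJ)
    collect = begin
      sumFin (λ k → sq k + ((lin k + wj k) + jj k))  ≡⟨ sum-+ sq (λ k → (lin k + wj k) + jj k) ⟩
      ΣX² + sumFin (λ k → (lin k + wj k) + jj k)     ≡⟨ cong (_+_ ΣX²) (sum-+ (λ k → lin k + wj k) jj) ⟩
      ΣX² + (sumFin (λ k → lin k + wj k) + ΣJJ)      ≡⟨ cong (λ z → ΣX² + (z + ΣJJ)) (sum-+ lin wj) ⟩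
      ΣX² + ((sumFin lin + ΣwJ) + ΣJJ)
        ≡⟨ cong (λ z → ΣX² + ((z + ΣwJ) + ΣJJ))
                (trans (sum-*ˡ W (λ k → X k * D - J k * D)) (cong (W *_) (sum-- (λ k → X k * D) (λ k → J k * D)))) ⟩
      ΣX² + ((W * (ΣX - ΣJ) + ΣwJ) + ΣJJ) ∎
      where
      sq lin wj jj : Fin (suc m) → ℚ
      sq k  = (X k * X k) * D
      lin k = W * (X k * D - J k * D)
      wj k  = (w k * J k) * D
      jj k  = (J k * (J k + 1ℚ)) * D
    per-index : ∀ x j n d → ((x - j) * (((x - (n + n)) + j) - 1ℚ)) * d ≡
      (x * x) * d + (((- (n + n + 1ℚ)) * (x * d - j * d) + ((- (j + j + 1ℚ)) * j) * d) + (j * (j + 1ℚ)) * d)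
    per-index = solve 4 (λ x j n d → ((x :- j) :* (((x :- (n :+ n)) :+ j) :- con 1ℚ)) :* d :=
      (x :* x) :* d :+ (((:- (n :+ n :+ con 1ℚ)) :* (x :* d :- j :* d) :+ ((:- (j :+ j :+ con 1ℚ)) :* j) :* d)
        :+ (j :* (j :+ con 1ℚ)) :* d)) refl

lemma4p2 : (n : ℕ) (a : Fin n → ℕ) → SmallerElements n a →
    sumFin (λ k → det (matMk a k)) ≡ intToℚ (coeff n a) * det (matM a)
lemma4p2 zero    a _ = sym (QP.*-zeroˡ 1ℚ)
lemma4p2 (suc m) a _ = begin
  sumFin (λ k → det (matMk a k))          ≡⟨ sum-det-Mk ⟩
  sumFin (λ k → summand k * D)            ≡⟨ sum-*ʳ summand D ⟩
  sumFin summand * D                      ≡⟨ cong (_* D) (sym coeff-as-ℚ) ⟩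
  intToℚ (coeff (suc m) a) * det (matM a) ∎
  where
  open ≡-Reasoning
  open Computation m a
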